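{- Let $\pi$ be a projective plane of order $q$, let $n$ be an integer with $2\leq q-n\leq q$, and let $\phi$ be an embedding of $G=K_{q-n,q}$ into $\pi$, where $V(G)=U\cup V$ is the bipartition with $|U|=q-n$ and $|V|=q$. If $q>n^2$, then the points $\phi(U\cup V)$ lie on two lines of $\pi$.
   Context: Graphs are finite, simple and undirected. An embedding of a graph $G=(V,E)$ into a projective plane $\pi=(\mathcal P,\mathcal L,\mathcal I)$ is an injective map $\phi:V\to\mathcal P$ such that the induced map $E\to\mathcal L$, sending an edge $ab$ to the unique line through $\phi(a)$ and $\phi(b)$, is injective. -}

module Defs where

open import Data.Nat using (ℕ; suc)
open import Data.Fin using (Fin)
open import Data.Sum using (_⊎_; inj₁; inj₂)
open import Data.Product using (Σ; _×_; _,_; proj₁)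
open import Relation.Nullary using (¬_)
open import Relation.Binary.PropositionalEquality using (_≡_; _≢_)
open import Function.Bundles using (_↔_)

record ProjectivePlane : Set₁ where
  field
    Point : Set
    Line  : Set
    _I_   : Point → Line → Set
    I-prop : ∀ {p l} (a b : p I l) → a ≡ b
    two-points : ∀ p p' → p ≢ p' →
      Σ Line λ l → (p I l) × (p' I l) × (∀ l' → p I l' → p' I l' → l' ≡ l)
    two-lines : ∀ l l' → l ≢ l' →
      Σ Point λ p → (p I l) × (p I l') × (∀ p' → p' I l → p' I l' → p' ≡ p)
    quadrangle : Σ (Fin 4 → Point) λ f →
      (∀ i j → i ≢ j → f i ≢ f j) ×
      (∀ i j k → i ≢ j → j ≢ k → i ≢ k → ∀ l → ¬ ((f i I l) × (f j I l) × (f k I l)))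

  join : (p p' : Point) → p ≢ p' → Line
  join p p' ne = proj₁ (two-points p p' ne)

open ProjectivePlane public

HasOrder : ProjectivePlane → ℕ → Set
HasOrder π q = ∀ (l : Line π) → (Σ (Point π) λ p → _I_ π p l) ↔ Fin (suc q)

-- The complete bipartite graph K_{a,b}: vertex set Fin a ⊎ Fin b
-- (U = inj₁ side, V = inj₂ side); edges are the pairs (u , v).
Vertex : ℕ → ℕ → Set
Vertex a b = Fin a ⊎ Fin b

edge-distinct : (π : ProjectivePlane) {a b : ℕ} (φ : Vertex a b → Point π) →
  (∀ x y → φ x ≡ φ y → x ≡ y) → (u : Fin a) (v : Fin b) → φ (inj₁ u) ≢ φ (inj₂ v)
edge-distinct π φ inj u v eq with inj (inj₁ u) (inj₂ v) eq
... | ()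

edgeLine : (π : ProjectivePlane) {a b : ℕ} (φ : Vertex a b → Point π) →
  (∀ x y → φ x ≡ φ y → x ≡ y) → Fin a × Fin b → Line π
edgeLine π φ inj (u , v) = join π (φ (inj₁ u)) (φ (inj₂ v)) (edge-distinct π φ inj u v)

record Embedding (π : ProjectivePlane) (a b : ℕ) : Set where
  field
    φ : Vertex a b → Point π
    φ-inj : ∀ x y → φ x ≡ φ y → x ≡ y
    edgeLine-inj : ∀ e e' → edgeLine π φ φ-inj e ≡ edgeLine π φ φ-inj e' → e ≡ e'

open Embedding public

-- The points of U lie on the line l₁ through two of them: a point of U off l₁ would give
-- q + 2 distinct lines through a fixed point of U (its q edges, l₁, and the line to that
-- point). No point of V lies on l₁. Suppose some point w of V is off the line l₂ through
-- two points V₀, V₁ of V. Send each of the other q − 1 points of V to the point where its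
-- line to V₀ meets l₁. These images avoid the q − n points of U, and each fibre (the points
-- of V other than V₀ on one line m through V₀) has at most n − 1 elements: projecting the
-- points of V on m from a point of V off m (w or V₁) gives distinct points of l₁ outside U
-- and different from m ∩ l₁. Hence q − 1 ≤ (n − 1)(n + 1) = n² − 1, contradicting n² < q.
module Submission where

open import Defs
open import Data.Nat using (ℕ; zero; suc; pred; _+_; _*_; _∸_; _≤_; _<_; z≤n; s≤s)
open import Data.Nat.Properties
  using (+-comm; *-suc; *-identityʳ; +-mono-≤; ≤-pred; 1+n≰n; <⇒≱; m+n≤o⇒m≤o; m+n≤o⇒n≤o;
         m+n≤o⇒m≤o∸n; m+n∸n≡m; m∸n+n≡m; m∸n≤m; m∸[m∸n]≡n; +-∸-assoc; pred[m∸n]≡m∸[1+n];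
         +-*-semiring; +-commutativeSemigroup; module ≤-Reasoning)
open import Data.Fin using (Fin; zero; suc)
open import Data.Fin.Properties using (_≟_; 0≢1+n; suc-injective; injective⇒≤; +↔⊎; all?; ¬∀⟶∃¬)
open import Data.Vec.Functional using (_∷_; _++_)
open import Data.Vec.Functional.Relation.Unary.All.Properties using (++⁺)
open import Data.Product using (Σ; _×_; _,_; proj₁; proj₂)
open import Data.Sum using (_⊎_; inj₁; inj₂; [_,_]′)
open import Data.Sum.Properties using (inj₁-injective; inj₂-injective)
open import Data.Empty using (⊥-elim)
open import Function using (_∘_)
open import Function.Bundles using (Injection)
open import Function.Definitions using (Injective)
open import Function.Properties.Inverse using (↔⇒↣)
open import Relation.Nullary using (¬_; Dec; yes; no)
open import Relation.Nullary.Decidable using (map′)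
open import Relation.Binary.PropositionalEquality

open import Algebra.Properties.Semiring.Sum +-*-semiring
  using (sum; sum-cong-≗; sum-replicate-zero; *-distribˡ-sum)
open import Algebra.Properties.CommutativeSemigroup +-commutativeSemigroup
  using (interchange)

∷-injective : ∀ {A : Set} {n} {x : A} {xs : Fin n → A} →
  (∀ i → xs i ≢ x) → Injective _≡_ _≡_ xs → Injective _≡_ _≡_ (x ∷ xs)
∷-injective x∉xs xs-inj {zero}  {zero}  _ = refl
∷-injective x∉xs xs-inj {zero}  {suc j} e = ⊥-elim (x∉xs j (sym e))
∷-injective x∉xs xs-inj {suc i} {zero}  e = ⊥-elim (x∉xs i e)
∷-injective x∉xs xs-inj {suc i} {suc j} e = cong suc (xs-inj e)

++-injective : ∀ {A : Set} {m n} {xs : Fin m → A} {ys : Fin n → A} →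
  Injective _≡_ _≡_ xs → Injective _≡_ _≡_ ys → (∀ i j → xs i ≢ ys j) →
  Injective _≡_ _≡_ (xs ++ ys)
++-injective {m = m} {n} {xs} {ys} xs-inj ys-inj disjoint e =
  Injection.injective (↔⇒↣ (+↔⊎ {m} {n})) (case-injective e)
  where
  case-injective : Injective _≡_ _≡_ [ xs , ys ]′
  case-injective {inj₁ i} {inj₁ j} e = cong inj₁ (xs-inj e)
  case-injective {inj₁ i} {inj₂ j} e = ⊥-elim (disjoint i j e)
  case-injective {inj₂ i} {inj₁ j} e = ⊥-elim (disjoint j i (sym e))
  case-injective {inj₂ i} {inj₂ j} e = cong inj₂ (ys-inj e)

sum-ones : ∀ n → sum {n} (λ _ → 1) ≡ n
sum-ones zero    = refl
sum-ones (suc n) = cong suc (sum-ones n)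

sum-+ : ∀ {n} (g h : Fin n → ℕ) → sum (λ i → g i + h i) ≡ sum g + sum h
sum-+ {zero}  g h = refl
sum-+ {suc n} g h = begin
  (g zero + h zero) + sum (λ i → g (suc i) + h (suc i))
    ≡⟨ cong (g zero + h zero +_) (sum-+ (g ∘ suc) (h ∘ suc)) ⟩
  (g zero + h zero) + (sum (g ∘ suc) + sum (h ∘ suc))
    ≡⟨ interchange (g zero) (h zero) _ _ ⟩
  (g zero + sum (g ∘ suc)) + (h zero + sum (h ∘ suc))
    ∎
  where open ≡-Reasoning

sum-mono-≤ : ∀ {n} {g h : Fin n → ℕ} → (∀ i → g i ≤ h i) → sum g ≤ sum h
sum-mono-≤ {zero}  g≤h = z≤n
sum-mono-≤ {suc n} g≤h = +-mono-≤ (g≤h zero) (sum-mono-≤ (g≤h ∘ suc))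

δ : ∀ {n} → Fin n → Fin n → ℕ
δ zero    zero    = 1
δ zero    (suc _) = 0
δ (suc _) zero    = 0
δ (suc x) (suc y) = δ x y

δ-cases : ∀ {n} (x y : Fin n) → δ x y ≡ 0 ⊎ (x ≡ y × δ x y ≡ 1)
δ-cases zero    zero    = inj₂ (refl , refl)
δ-cases zero    (suc y) = inj₁ refl
δ-cases (suc x) zero    = inj₁ refl
δ-cases (suc x) (suc y) with δ-cases x y
... | inj₁ δ≡0         = inj₁ δ≡0
... | inj₂ (refl , δ≡1) = inj₂ (refl , δ≡1)

sum-δ : ∀ {n} (x : Fin n) → sum (δ x) ≡ 1
sum-δ {suc n} zero    = cong suc (sum-replicate-zero n)
sum-δ         (suc x) = sum-δ x

count : ∀ {A B} → (Fin A → Fin B) → Fin B → ℕ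
count f y = sum (λ x → δ (f x) y)

sum-count : ∀ {A B} (f : Fin A → Fin B) → sum (count f) ≡ A
sum-count {zero}  {B} f = sum-replicate-zero B
sum-count {suc A}     f = begin
  sum (λ y → δ (f zero) y + count (f ∘ suc) y)  ≡⟨ sum-+ (δ (f zero)) (count (f ∘ suc)) ⟩
  sum (δ (f zero)) + sum (count (f ∘ suc))
    ≡⟨ cong₂ _+_ (sum-δ (f zero)) (sum-count (f ∘ suc)) ⟩
  suc A                                         ∎
  where open ≡-Reasoning

FibreFamily : ∀ {A B} → (Fin A → Fin B) → Fin B → ℕ → Set
FibreFamily {A} f y j = Σ (Fin j → Fin A) λ g → Injective _≡_ _≡_ g × (∀ i → f (g i) ≡ y)

fibre-enumeration : ∀ {A B} (f : Fin A → Fin B) y → FibreFamily f y (count f y)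
fibre-enumeration {zero}  f y = (λ ()) , (λ { {()} }) , (λ ())
fibre-enumeration {suc A} f y = extend (fibre-enumeration (f ∘ suc) y)
  where
  extend : ∀ {j} → FibreFamily (f ∘ suc) y j → FibreFamily f y (δ (f zero) y + j)
  extend (g , g-inj , fg) with δ (f zero) y | δ-cases (f zero) y
  ... | _ | inj₁ refl =
    suc ∘ g , (λ e → g-inj (suc-injective e)) , fg
  ... | _ | inj₂ (f0≡y , refl) =
    zero ∷ (suc ∘ g) , ∷-injective (λ _ ()) (λ e → g-inj (suc-injective e))
                     , λ { zero → f0≡y ; (suc i) → fg i }

count≡0 : ∀ {A B} (f : Fin A → Fin B) y → (∀ x → f x ≢ y) → count f y ≡ 0
count≡0 f y f≢y with count f y | fibre-enumeration f y
... | zero  | _          = refl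
... | suc _ | g , _ , fg = ⊥-elim (f≢y (g zero) (fg zero))

injective⇒count≤1 : ∀ {k B} {h : Fin k → Fin B} → Injective _≡_ _≡_ h → ∀ y → count h y ≤ 1
injective⇒count≤1 {h = h} h-inj y with fibre-enumeration h y
... | g , g-inj , hg =
  injective⇒≤ {f = λ _ → zero} λ {i} {j} _ → g-inj (h-inj (trans (hg i) (sym (hg j))))

sum-1∸count : ∀ {k B} {h : Fin k → Fin B} → Injective _≡_ _≡_ h →
  sum (λ y → 1 ∸ count h y) ≡ B ∸ k
sum-1∸count {k} {B} {h} h-inj = begin
  uncounted                                ≡⟨ m+n∸n≡m uncounted k ⟨
  uncounted + k ∸ k                        ≡⟨ cong (λ t → uncounted + t ∸ k) (sum-count h) ⟨
  uncounted + sum (count h) ∸ k            ≡⟨ cong (_∸ k) (sum-+ (λ y → 1 ∸ count h y) (count h)) ⟨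
  sum (λ y → (1 ∸ count h y) + count h y) ∸ k
    ≡⟨ cong (_∸ k) (sum-cong-≗ λ y → m∸n+n≡m (injective⇒count≤1 h-inj y)) ⟩
  sum {B} (λ _ → 1) ∸ k                    ≡⟨ cong (_∸ k) (sum-ones B) ⟩
  B ∸ k                                    ∎
  where
  open ≡-Reasoning
  uncounted = sum (λ y → 1 ∸ count h y)

generalised-pigeonhole : ∀ {A B k} (c : ℕ) (f : Fin A → Fin B) (h : Fin k → Fin B) →
  Injective _≡_ _≡_ h → (∀ x u → f x ≢ h u) → (∀ y {j} → FibreFamily f y j → j ≤ c) →
  A ≤ c * (B ∸ k)
generalised-pigeonhole {A} {B} {k} c f h h-inj f≢h fibre≤c = begin
  A                                  ≡⟨ sum-count f ⟨
  sum (count f)                      ≤⟨ sum-mono-≤ count≤ ⟩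
  sum (λ y → c * (1 ∸ count h y))    ≡⟨ *-distribˡ-sum c (λ y → 1 ∸ count h y) ⟨
  c * sum (λ y → 1 ∸ count h y)      ≡⟨ cong (c *_) (sum-1∸count h-inj) ⟩
  c * (B ∸ k)                        ∎
  where
  open ≤-Reasoning
  count≤ : ∀ y → count f y ≤ c * (1 ∸ count h y)
  count≤ y with count f y | fibre-enumeration f y
  ... | zero  | _ = z≤n
  ... | suc j | fibre@(g , _ , fg) = begin
    suc j                 ≤⟨ fibre≤c y fibre ⟩
    c                     ≡⟨ *-identityʳ c ⟨
    c * 1                 ≡⟨ cong (λ t → c * (1 ∸ t)) h-misses-y ⟨
    c * (1 ∸ count h y)   ∎
    where
    h-misses-y : count h y ≡ 0
    h-misses-y = count≡0 h y λ u hu≡y → f≢h (g zero) u (trans (fg zero) (sym hu≡y))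

module Incidence (π : ProjectivePlane) where

  _∈_ : Point π → Line π → Set
  p ∈ l = _I_ π p l

  _∉_ : Point π → Line π → Set
  p ∉ l = ¬ p ∈ l

  join-∋ˡ : ∀ {p p' p≢p'} → p ∈ join π p p' p≢p'
  join-∋ˡ {p} {p'} {p≢p'} = proj₁ (proj₂ (two-points π p p' p≢p'))

  join-∋ʳ : ∀ {p p' p≢p'} → p' ∈ join π p p' p≢p'
  join-∋ʳ {p} {p'} {p≢p'} = proj₁ (proj₂ (proj₂ (two-points π p p' p≢p')))

  join-unique : ∀ {p p' p≢p' l} → p ∈ l → p' ∈ l → l ≡ join π p p' p≢p'
  join-unique {p} {p'} {p≢p'} {l} = proj₂ (proj₂ (proj₂ (two-points π p p' p≢p'))) l

  line-unique : ∀ {p p' l l'} → p ≢ p' → p ∈ l → p' ∈ l → p ∈ l' → p' ∈ l' → l ≡ l'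
  line-unique p≢p' p∈l p'∈l p∈l' p'∈l' =
    trans (join-unique {p≢p' = p≢p'} p∈l p'∈l) (sym (join-unique p∈l' p'∈l'))

  meet : (l l' : Line π) → l ≢ l' → Point π
  meet l l' l≢l' = proj₁ (two-lines π l l' l≢l')

  meet-∈ˡ : ∀ {l l' l≢l'} → meet l l' l≢l' ∈ l
  meet-∈ˡ {l} {l'} {l≢l'} = proj₁ (proj₂ (two-lines π l l' l≢l'))

  meet-∈ʳ : ∀ {l l' l≢l'} → meet l l' l≢l' ∈ l'
  meet-∈ʳ {l} {l'} {l≢l'} = proj₁ (proj₂ (proj₂ (two-lines π l l' l≢l')))

  point-unique : ∀ {p p' l l'} → l ≢ l' → p ∈ l → p ∈ l' → p' ∈ l → p' ∈ l' → p ≡ p'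
  point-unique {p} {p'} {l} {l'} l≢l' p∈l p∈l' p'∈l p'∈l' =
    trans (unique p p∈l p∈l') (sym (unique p' p'∈l p'∈l'))
    where unique = proj₂ (proj₂ (proj₂ (two-lines π l l' l≢l')))

  ∈∉⇒≢ : ∀ {p p' l} → p ∈ l → p' ∉ l → p ≢ p'
  ∈∉⇒≢ p∈l p'∉l refl = p'∉l p∈l

  ∈∉⇒line≢ : ∀ {p l l'} → p ∈ l → p ∉ l' → l ≢ l'
  ∈∉⇒line≢ p∈l p∉l' refl = p∉l' p∈l

module FiniteOrder (π : ProjectivePlane) {q : ℕ} (ord : HasOrder π q) where
  open Incidence π

  position : ∀ l {p} → p ∈ l → Fin (suc q)
  position l {p} p∈l = Injection.to (↔⇒↣ (ord l)) (p , p∈l)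

  position-injective : ∀ {l p p'} (p∈l : p ∈ l) (p'∈l : p' ∈ l) →
    position l p∈l ≡ position l p'∈l → p ≡ p'
  position-injective {l} _ _ e = cong proj₁ (Injection.injective (↔⇒↣ (ord l)) e)

  ≟-on-line : ∀ {l p p'} → p ∈ l → p' ∈ l → Dec (p ≡ p')
  ≟-on-line {l} p∈l p'∈l = map′ (position-injective p∈l p'∈l)
    (λ { refl → cong (position l) (I-prop π p∈l p'∈l) })
    (position l p∈l ≟ position l p'∈l)

  collinear-bound : ∀ {m l} (P : Fin m → Point π) → Injective _≡_ _≡_ P →
    (∀ i → P i ∈ l) → m ≤ suc q
  collinear-bound {l = l} P P-inj P∈l =
    injective⇒≤ {f = λ i → position l (P∈l i)} λ e → P-inj (position-injective _ _ e)

  module Pencil {x n} (x∉n : x ∉ n) where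

    trace : ∀ {l} → x ∈ l → Point π
    trace x∈l = meet _ n (∈∉⇒line≢ x∈l x∉n)

    trace-injective : ∀ {l l'} (x∈l : x ∈ l) (x∈l' : x ∈ l') →
      trace x∈l ≡ trace x∈l' → l ≡ l'
    trace-injective x∈l x∈l' e =
      line-unique (∈∉⇒≢ meet-∈ʳ x∉n) meet-∈ˡ x∈l (subst (_∈ _) (sym e) meet-∈ˡ) x∈l'

    concurrent-bound : ∀ {m} (L : Fin m → Line π) → Injective _≡_ _≡_ L →
      (∀ i → x ∈ L i) → m ≤ suc q
    concurrent-bound L L-inj x∈L =
      collinear-bound (λ i → trace (x∈L i))
        (λ {i} {j} e → L-inj (trace-injective (x∈L i) (x∈L j) e)) (λ _ → meet-∈ʳ)

    line-≟ : ∀ {l l'} → x ∈ l → x ∈ l' → Dec (l ≡ l')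
    line-≟ x∈l x∈l' = map′ (trace-injective x∈l x∈l')
      (λ { refl → point-unique (∈∉⇒line≢ x∈l x∉n) meet-∈ˡ meet-∈ʳ meet-∈ˡ meet-∈ʳ })
      (≟-on-line {n} meet-∈ʳ meet-∈ʳ)

    ∈-dec : ∀ {l} → x ∈ l → ∀ {p} → p ≢ x → Dec (p ∈ l)
    ∈-dec x∈l {p} p≢x = map′
      (λ xp≡l → subst (p ∈_) xp≡l join-∋ʳ)
      (λ p∈l → line-unique x≢p join-∋ˡ join-∋ʳ x∈l p∈l)
      (line-≟ (join-∋ˡ {p≢p' = x≢p}) x∈l)
      where x≢p = p≢x ∘ sym

-- U has 1 + a points and V has 1 + q points, 1 + q being the order of π; u₁ and v₁ only
-- name second points U (suc u₁) and V (suc v₁).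
module Embedded (π : ProjectivePlane) {q a : ℕ} (ord : HasOrder π (suc q))
                (emb : Embedding π (suc a) (suc q)) (u₁ : Fin a) (v₁ : Fin q) where
  open Incidence π
  open FiniteOrder π ord

  U : Fin (suc a) → Point π
  U u = φ emb (inj₁ u)

  V : Fin (suc q) → Point π
  V v = φ emb (inj₂ v)

  E : Fin (suc a) → Fin (suc q) → Line π
  E u v = edgeLine π (φ emb) (φ-inj emb) (u , v)

  U-injective : Injective _≡_ _≡_ U
  U-injective e = inj₁-injective (φ-inj emb _ _ e)

  V-injective : Injective _≡_ _≡_ V
  V-injective e = inj₂-injective (φ-inj emb _ _ e)

  E-unique : ∀ {u v l} → U u ∈ l → V v ∈ l → l ≡ E u v
  E-unique = join-unique

  UUV-noncollinear : ∀ {u u' v l} → u ≢ u' → U u ∈ l → U u' ∈ l → V v ∉ l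
  UUV-noncollinear u≢u' Uu∈l Uu'∈l Vv∈l = u≢u' (cong proj₁ (edgeLine-inj emb _ _
    (trans (sym (E-unique Uu∈l Vv∈l)) (E-unique Uu'∈l Vv∈l))))

  UVV-noncollinear : ∀ {u v v' l} → v ≢ v' → U u ∈ l → V v ∈ l → V v' ∉ l
  UVV-noncollinear v≢v' Uu∈l Vv∈l Vv'∈l = v≢v' (cong proj₂ (edgeLine-inj emb _ _
    (trans (sym (E-unique Uu∈l Vv∈l)) (E-unique Uu∈l Vv'∈l))))

  l₁ : Line π
  l₁ = join π (U zero) (U (suc u₁)) (0≢1+n ∘ U-injective)

  V∉l₁ : ∀ v → V v ∉ l₁
  V∉l₁ v = UUV-noncollinear 0≢1+n join-∋ˡ join-∋ʳ

  U₀∉E₁₀ : U zero ∉ E (suc u₁) zero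
  U₀∉E₁₀ U₀∈E = UUV-noncollinear 0≢1+n U₀∈E join-∋ˡ join-∋ʳ

  U∈l₁ : ∀ u → U u ∈ l₁
  U∈l₁ zero = join-∋ˡ
  U∈l₁ (suc u) with Pencil.∈-dec U₀∉E₁₀ join-∋ˡ (0≢1+n ∘ sym ∘ U-injective)
  ... | yes Uu∈l₁ = Uu∈l₁
  ... | no  Uu∉l₁ =
    ⊥-elim (1+n≰n (Pencil.concurrent-bound U₀∉E₁₀ lines lines-injective lines-∋U₀))
    where
    U₀≢Uu : U zero ≢ U (suc u)
    U₀≢Uu = 0≢1+n ∘ U-injective
    lines : Fin (suc (suc (suc q))) → Line π
    lines = l₁ ∷ join π (U zero) (U (suc u)) U₀≢Uu ∷ E zero
    lines-injective : Injective _≡_ _≡_ lines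
    lines-injective = ∷-injective
      (λ { zero → ∈∉⇒line≢ join-∋ʳ Uu∉l₁ ; (suc v) → ∈∉⇒line≢ join-∋ʳ (V∉l₁ v) })
      (∷-injective
        (λ v E≡join → UUV-noncollinear 0≢1+n join-∋ˡ
                        (subst (U (suc u) ∈_) (sym E≡join) join-∋ʳ) join-∋ʳ)
        (λ e → cong proj₂ (edgeLine-inj emb _ _ e)))
    lines-∋U₀ : ∀ i → U zero ∈ lines i
    lines-∋U₀ zero = join-∋ˡ
    lines-∋U₀ (suc zero) = join-∋ˡ
    lines-∋U₀ (suc (suc v)) = join-∋ˡ

  V-on-line-bound : ∀ {m w j} → (∀ u → U u ∉ m) → V w ∉ m →
    (X : Fin j → Fin (suc q)) → Injective _≡_ _≡_ X → (∀ i → V (X i) ∈ m) →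
    j + suc a ≤ suc q
  V-on-line-bound {m} {w} {j} U∉m Vw∉m X X-inj X∈m =
    ≤-pred (collinear-bound points points-injective points∈l₁)
    where
    m≢l₁ : m ≢ l₁
    m≢l₁ = ≢-sym (∈∉⇒line≢ (U∈l₁ zero) (U∉m zero))
    p : Point π
    p = meet m l₁ m≢l₁
    w≢X : ∀ i → V w ≢ V (X i)
    w≢X i = ≢-sym (∈∉⇒≢ (X∈m i) Vw∉m)
    K : Fin j → Line π
    K i = join π (V w) (V (X i)) (w≢X i)
    K≢m : ∀ {i} → K i ≢ m
    K≢m = ∈∉⇒line≢ join-∋ˡ Vw∉m
    k : Fin j → Point π
    k i = meet (K i) l₁ (∈∉⇒line≢ join-∋ˡ (V∉l₁ w))
    points : Fin (suc j + suc a) → Point π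
    points = (p ∷ k) ++ U

    k-injective : Injective _≡_ _≡_ k
    k-injective {i} {i'} e =
      X-inj (V-injective (point-unique K≢m join-∋ʳ (X∈m i) X'∈K (X∈m i')))
      where
      K≡K' : K i ≡ K i'
      K≡K' = line-unique (≢-sym (∈∉⇒≢ meet-∈ʳ (V∉l₁ w))) join-∋ˡ meet-∈ˡ join-∋ˡ
        (subst (_∈ K i') (sym e) meet-∈ˡ)
      X'∈K : V (X i') ∈ K i
      X'∈K = subst (V (X i') ∈_) (sym K≡K') join-∋ʳ

    k≢p : ∀ i → k i ≢ p
    k≢p i e = Vw∉m (subst (V w ∈_) K≡m join-∋ˡ)
      where
      K≡m : K i ≡ m
      K≡m = line-unique (∈∉⇒≢ meet-∈ʳ (V∉l₁ (X i))) (subst (_∈ K i) e meet-∈ˡ) join-∋ʳ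
        meet-∈ˡ (X∈m i)

    p∷k≢U : ∀ i u → (p ∷ k) i ≢ U u
    p∷k≢U zero    u = ∈∉⇒≢ meet-∈ˡ (U∉m u)
    p∷k≢U (suc i) u e =
      UVV-noncollinear (w≢X i ∘ cong V) (subst (_∈ K i) e meet-∈ˡ) join-∋ˡ join-∋ʳ

    points-injective : Injective _≡_ _≡_ points
    points-injective = ++-injective (∷-injective k≢p k-injective) U-injective p∷k≢U

    points∈l₁ : ∀ i → points i ∈ l₁
    points∈l₁ = ++⁺ (_∈ l₁) {xs = p ∷ k} (λ { zero → meet-∈ʳ ; (suc i) → meet-∈ʳ }) U∈l₁

  l₂ : Line π
  l₂ = join π (V zero) (V (suc v₁)) (0≢1+n ∘ V-injective)

  V₀∉E₀₁ : V zero ∉ E zero (suc v₁)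
  V₀∉E₀₁ = UVV-noncollinear (λ ()) join-∋ˡ join-∋ʳ

  V∈l₂? : ∀ v → Dec (V v ∈ l₂)
  V∈l₂? zero    = yes join-∋ˡ
  V∈l₂? (suc v) = Pencil.∈-dec V₀∉E₀₁ join-∋ˡ (0≢1+n ∘ sym ∘ V-injective)

  M : Fin q → Line π
  M i = join π (V zero) (V (suc i)) (0≢1+n ∘ V-injective)

  M∩l₁ : Fin q → Point π
  M∩l₁ i = meet (M i) l₁ (∈∉⇒line≢ join-∋ˡ (V∉l₁ zero))

  U∉M : ∀ i u → U u ∉ M i
  U∉M i u Uu∈M = UVV-noncollinear 0≢1+n Uu∈M join-∋ˡ join-∋ʳ

  M-position : Fin q → Fin (suc (suc q))
  M-position i = position l₁ {M∩l₁ i} meet-∈ʳ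

  U-position : Fin (suc a) → Fin (suc (suc q))
  U-position u = position l₁ (U∈l₁ u)

  U-position-injective : Injective _≡_ _≡_ U-position
  U-position-injective e = U-injective (position-injective _ _ e)

  M-position≢U-position : ∀ i u → M-position i ≢ U-position u
  M-position≢U-position i u e = U∉M i u (subst (_∈ M i) (position-injective _ _ e) meet-∈ˡ)

  M-position-determines-M : ∀ {i i'} → M-position i ≡ M-position i' → M i ≡ M i'
  M-position-determines-M e = line-unique (≢-sym (∈∉⇒≢ meet-∈ʳ (V∉l₁ zero))) join-∋ˡ meet-∈ˡ
    join-∋ˡ (subst (_∈ M _) (sym (position-injective _ _ e)) meet-∈ˡ)

  module _ {w} (Vw∉l₂ : V w ∉ l₂) where

    V-off-line : ∀ {m} → V zero ∈ m → Σ (Fin (suc q)) λ w' → V w' ∉ m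
    V-off-line V₀∈m with Pencil.∈-dec V₀∉E₀₁ V₀∈m (≢-sym (∈∉⇒≢ join-∋ˡ Vw∉l₂))
    ... | no  Vw∉m = w , Vw∉m
    ... | yes Vw∈m = suc v₁ , λ V₁∈m →
      Vw∉l₂ (subst (V w ∈_) (line-unique (0≢1+n ∘ V-injective) V₀∈m V₁∈m join-∋ˡ join-∋ʳ) Vw∈m)

    fibre-bound : ∀ y {j} → FibreFamily M-position y j → j ≤ q ∸ suc a
    fibre-bound y {zero}  _ = z≤n
    fibre-bound y {suc j} (g , g-inj , g-in-fibre) = m+n≤o⇒m≤o∸n (suc j)
      (≤-pred (V-on-line-bound (U∉M (g zero)) (proj₂ off) X X-injective X∈M))
      where
      off : Σ (Fin (suc q)) λ w' → V w' ∉ M (g zero)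
      off = V-off-line join-∋ˡ
      X : Fin (suc (suc j)) → Fin (suc q)
      X = zero ∷ (suc ∘ g)
      X-injective : Injective _≡_ _≡_ X
      X-injective = ∷-injective (λ _ ()) (g-inj ∘ suc-injective)
      X∈M : ∀ i → V (X i) ∈ M (g zero)
      X∈M zero    = join-∋ˡ
      X∈M (suc i) = subst (V (suc (g i)) ∈_)
        (M-position-determines-M (trans (g-in-fibre i) (sym (g-in-fibre zero)))) join-∋ʳ

  covering-lines : ¬ q ≤ (q ∸ suc a) * (suc q ∸ a) →
    Σ (Line π) λ l → Σ (Line π) λ l' → ∀ x → φ emb x ∈ l ⊎ φ emb x ∈ l'
  covering-lines few with all? V∈l₂?
  ... | yes V∈l₂ = l₁ , l₂ , λ { (inj₁ u) → inj₁ (U∈l₁ u) ; (inj₂ v) → inj₂ (V∈l₂ v) }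
  ... | no ¬V∈l₂ with ¬∀⟶∃¬ _ _ V∈l₂? ¬V∈l₂
  ...   | w , Vw∉l₂ = ⊥-elim (few (generalised-pigeonhole (q ∸ suc a) M-position U-position
                        U-position-injective M-position≢U-position (fibre-bound Vw∉l₂)))

covered-by-two-lines : (π : ProjectivePlane) {Q A : ℕ} → HasOrder π Q → (emb : Embedding π A Q) →
  2 ≤ A → 2 ≤ Q → (Q ∸ suc A) * (suc Q ∸ A) < pred Q →
  Σ (Line π) λ l → Σ (Line π) λ l' → ∀ x → _I_ π (φ emb x) l ⊎ _I_ π (φ emb x) l'
covered-by-two-lines π ord emb (s≤s (s≤s _)) (s≤s (s≤s _)) few =
  Embedded.covering-lines π ord emb zero zero (<⇒≱ few)

pred[n]*[1+n]<pred[q] : ∀ n q → 2 ≤ q → n * n < q → pred n * suc n < pred q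
pred[n]*[1+n]<pred[q] zero    (suc q) (s≤s 1≤q) _ = 1≤q
pred[n]*[1+n]<pred[q] (suc n) (suc q) _ (s≤s [1+n]²≤q) =
  subst (_< q) (sym (*-suc n (suc n))) [1+n]²≤q

theorem3p9 : (π : ProjectivePlane) (q n : ℕ) → HasOrder π q →
    n + 2 ≤ q → n * n < q → (emb : Embedding π (q ∸ n) q) →
    Σ (Line π) λ l₁ → Σ (Line π) λ l₂ →
      ∀ x → (_I_ π (φ emb x) l₁) ⊎ (_I_ π (φ emb x) l₂)
theorem3p9 π q n ord n+2≤q n*n<q emb =
  covered-by-two-lines π ord emb 2≤|U| 2≤q
    (subst₂ (λ s t → s * t < pred q) (sym q∸[1+|U|]≡pred[n]) (sym [1+q]∸|U|≡1+n)
      (pred[n]*[1+n]<pred[q] n q 2≤q n*n<q))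
  where
  2≤q : 2 ≤ q
  2≤q = m+n≤o⇒n≤o n n+2≤q
  2≤|U| : 2 ≤ q ∸ n
  2≤|U| = m+n≤o⇒m≤o∸n 2 (subst (_≤ q) (+-comm n 2) n+2≤q)
  q∸|U|≡n : q ∸ (q ∸ n) ≡ n
  q∸|U|≡n = m∸[m∸n]≡n (m+n≤o⇒m≤o n n+2≤q)
  q∸[1+|U|]≡pred[n] : q ∸ suc (q ∸ n) ≡ pred n
  q∸[1+|U|]≡pred[n] = trans (sym (pred[m∸n]≡m∸[1+n] q (q ∸ n))) (cong pred q∸|U|≡n)
  [1+q]∸|U|≡1+n : suc q ∸ (q ∸ n) ≡ suc n
  [1+q]∸|U|≡1+n = trans (+-∸-assoc 1 (m∸n≤m q n)) (cong suc q∸|U|≡n)
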